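{- Consider the idealized process with $m \geq 6n$ balls and $n$ bins, started at round $t_0$ from a fixed load vector $y^{t_0}$, and let $t_3 \geq t_0$. Regard $G_{t_0}^{t_3} := \sum_{t=t_0}^{t_3} \sum_{i \in [n]} \mathbf{1}_{y_i^t=0}$ as a function $f\big((Z_i^{t})_{t \in [t_0,t_3), i \in [n]}\big)$ of the independent random variables $Z_i^t$. Then changing the value of a single $Z_j^{t}$ changes $G_{t_0}^{t_3}$ by at most $1$.
   Context: Idealized process started at round $t_0$ from a load vector $y^{t_0}$ of $m$ balls in $n$ bins: for each $t \ge t_0$, with $Z_1^t,\dots,Z_n^t$ independent uniform samples from $[n]$, $y_i^{t+1} := y_i^t - \mathbf{1}_{y_i^t>0} + \sum_{j=1}^n \mathbf{1}_{Z_j^t=i}$; the values of the $Z_i^t$ completely determine $y^t$ for all $t\ge t_0$. -}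

module Defs where

open import Data.Nat using (ℕ; zero; suc; _+_; _∸_)
open import Data.Fin using (Fin; _≟_)
open import Data.List using (List; map; allFin; applyUpTo)
open import Data.Nat.ListAction using (sum)
open import Relation.Nullary.Decidable using (⌊_⌋)
open import Data.Bool using (if_then_else_)
import Data.Nat as ℕ

Load : ℕ → Set
Load n = Fin n → ℕ

total : ∀ {n} → Load n → ℕ
total {n} y = sum (map y (allFin n))

hits : ∀ {n} → (Fin n → Fin n) → Fin n → ℕ
hits {n} Z i = sum (map (λ j → if ⌊ Z j ≟ i ⌋ then 1 else 0) (allFin n))

-- One round: y_i' = y_i - 1_{y_i>0} + Σ_j 1_{Z_j = i}   (note y ∸ 1 = y - 1_{y>0}).
step : ∀ {n} → Load n → (Fin n → Fin n) → Load n
step y Z i = (y i ∸ 1) + hits Z i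

-- Z t j  is the random choice Z_j^t of round t (absolute round index t).
Choices : ℕ → Set
Choices n = ℕ → Fin n → Fin n

-- run y0 Z t0 k  =  y^{t0 + k}  for the process started at round t0 from y0.
run : ∀ {n} → Load n → Choices n → ℕ → ℕ → Load n
run y0 Z t0 zero    = y0
run y0 Z t0 (suc k) = step (run y0 Z t0 k) (Z (t0 + k))

loadAt : ∀ {n} → Load n → Choices n → (t0 t : ℕ) → Load n
loadAt y0 Z t0 t = run y0 Z t0 (t ∸ t0)

empties : ∀ {n} → Load n → ℕ
empties {n} y = sum (map (λ i → if ⌊ y i ℕ.≟ 0 ⌋ then 1 else 0) (allFin n))

-- G_{t0}^{t3} = Σ_{t = t0}^{t3} Σ_i 1_{y_i^t = 0}   (both endpoints included).
G : ∀ {n} → Load n → Choices n → (t0 t3 : ℕ) → ℕ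
G y0 Z t0 t3 = sum (applyUpTo (λ k → empties (loadAt y0 Z t0 (t0 + k))) (suc (t3 ∸ t0)))

-- Given its arrival sequence h (h k balls in round k), each bin evolves on its own as the
-- queue x ↦ (x ∸ 1) + h k, so G is the sum over bins of the number of rounds at which the
-- queue is empty.  In a single queue, d extra balls, added at the start or in any round,
-- remove at most d empty rounds and never add one.  Resampling Z_j^t moves one ball of
-- round t from one bin to another: the bin that loses the ball gains at most one empty
-- round, and the bin that receives it gains none.

module Submission where

open import Defs
open import Data.Nat using (ℕ; zero; suc; _+_; _*_; _∸_; _≤_; _<_; z≤n)
import Data.Nat as ℕ
open import Data.Nat.Properties hiding (_≟_)
open import Data.Fin using (Fin; zero; suc; toℕ; punchIn; _≟_)
open import Data.Fin.Properties using (punchInᵢ≢i)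
open import Data.Product using (_×_; _,_)
open import Data.List using (map; allFin; applyUpTo; tabulate)
open import Data.List.Properties using (map-tabulate)
open import Data.Nat.ListAction using (sum)
open import Data.Bool using (if_then_else_)
open import Function using (_∘_)
open import Relation.Nullary using (¬_; Dec; yes; no; contradiction)
open import Relation.Nullary.Decidable using (⌊_⌋)
open import Relation.Binary.PropositionalEquality
  using (_≡_; _≢_; _≗_; refl; sym; trans; cong; cong₂; subst; module ≡-Reasoning)
open import Algebra.Properties.CommutativeMonoid.Sum +-0-commutativeMonoid
  using (sum-syntax; sum-cong-≗; sum-remove; sum-replicate-zero; ∑-distrib-+; ∑-comm)
  renaming (sum to ∑)

𝟙 : ∀ {ℓ} {P : Set ℓ} → Dec P → ℕ
𝟙 d = if ⌊ d ⌋ then 1 else 0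

𝟙-yes : ∀ {ℓ} {P : Set ℓ} → P → (d : Dec P) → 𝟙 d ≡ 1
𝟙-yes _ (yes _) = refl
𝟙-yes p (no ¬p) = contradiction p ¬p

𝟙-no : ∀ {ℓ} {P : Set ℓ} → ¬ P → (d : Dec P) → 𝟙 d ≡ 0
𝟙-no ¬p (yes p) = contradiction p ¬p
𝟙-no ¬p (no _)  = refl

sum-tabulate : ∀ {n} (f : Fin n → ℕ) → sum (tabulate f) ≡ ∑ f
sum-tabulate {zero}  f = refl
sum-tabulate {suc n} f = cong (f zero +_) (sum-tabulate (f ∘ suc))

sum-map-allFin : ∀ {n} (f : Fin n → ℕ) → sum (map f (allFin n)) ≡ ∑ f
sum-map-allFin f = trans (cong sum (map-tabulate (λ i → i) f)) (sum-tabulate f)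

sum-applyUpTo : ∀ (f : ℕ → ℕ) N → sum (applyUpTo f N) ≡ ∑[ k < N ] f (toℕ k)
sum-applyUpTo f zero    = refl
sum-applyUpTo f (suc N) = cong (f 0 +_) (sum-applyUpTo (f ∘ suc) N)

∑-mono-≤ : ∀ {n} {f g : Fin n → ℕ} → (∀ i → f i ≤ g i) → ∑ f ≤ ∑ g
∑-mono-≤ {zero}  f≤g = z≤n
∑-mono-≤ {suc n} f≤g = +-mono-≤ (f≤g zero) (∑-mono-≤ (f≤g ∘ suc))

∑-mono-≤-except : ∀ {n} {f g : Fin n → ℕ} (j : Fin n) →
                  (∀ i → i ≢ j → f i ≤ g i) → ∑ f ≤ ∑ g + f j
∑-mono-≤-except {suc n} {f} {g} j f≤g = begin
  ∑ f                            ≡⟨ sum-remove f ⟩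
  f j + ∑ (f ∘ punchIn j)        ≤⟨ +-monoʳ-≤ (f j) (∑-mono-≤ (λ k → f≤g _ (punchInᵢ≢i j k))) ⟩
  f j + ∑ (g ∘ punchIn j)        ≤⟨ +-monoʳ-≤ (f j) (m≤n+m _ (g j)) ⟩
  f j + (g j + ∑ (g ∘ punchIn j)) ≡⟨ cong (f j +_) (sym (sum-remove g)) ⟩
  f j + ∑ g                      ≡⟨ +-comm (f j) _ ⟩
  ∑ g + f j                      ∎
  where open ≤-Reasoning

∑-𝟙-≟ : ∀ {n} (b : Fin n) → ∑[ i < n ] 𝟙 (b ≟ i) ≡ 1
∑-𝟙-≟ {suc n} b = begin
  ∑[ i < suc n ] 𝟙 (b ≟ i)                   ≡⟨ sum-remove (λ i → 𝟙 (b ≟ i)) ⟩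
  𝟙 (b ≟ b) + ∑[ k < n ] 𝟙 (b ≟ punchIn b k) ≡⟨ cong₂ _+_ (𝟙-yes refl (b ≟ b)) (sum-cong-≗ other) ⟩
  1 + ∑[ k < n ] 0                           ≡⟨ cong (1 +_) (sum-replicate-zero n) ⟩
  1                                          ∎
  where
  open ≡-Reasoning
  other : ∀ k → 𝟙 (b ≟ punchIn b k) ≡ 0
  other k = 𝟙-no (punchInᵢ≢i b k ∘ sym) (b ≟ punchIn b k)

queue : ℕ → (ℕ → ℕ) → ℕ → ℕ
queue x h zero    = x
queue x h (suc k) = (queue x h k ∸ 1) + h k

queue-suc : ∀ x h k → queue x h (suc k) ≡ queue ((x ∸ 1) + h 0) (h ∘ suc) k
queue-suc x h zero    = refl
queue-suc x h (suc k) = cong (λ y → (y ∸ 1) + h (suc k)) (queue-suc x h k)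

emptyRounds : ℕ → (ℕ → ℕ) → ℕ → ℕ
emptyRounds x h zero    = 0
emptyRounds x h (suc N) = 𝟙 (x ℕ.≟ 0) + emptyRounds ((x ∸ 1) + h 0) (h ∘ suc) N

emptyRounds-∑ : ∀ x h N → emptyRounds x h N ≡ ∑[ k < N ] 𝟙 (queue x h (toℕ k) ℕ.≟ 0)
emptyRounds-∑ x h zero    = refl
emptyRounds-∑ x h (suc N) = cong (𝟙 (x ℕ.≟ 0) +_) (trans (emptyRounds-∑ _ (h ∘ suc) N)
  (sum-cong-≗ {N} (λ k → cong (λ y → 𝟙 (y ℕ.≟ 0)) (sym (queue-suc x h (toℕ k))))))

emptyRounds-cong : ∀ x {h h′} N → h ≗ h′ → emptyRounds x h N ≡ emptyRounds x h′ N
emptyRounds-cong x zero    h≗h′ = refl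
emptyRounds-cong x (suc N) h≗h′ = cong (𝟙 (x ℕ.≟ 0) +_)
  (trans (cong (λ a → emptyRounds ((x ∸ 1) + a) _ N) (h≗h′ 0)) (emptyRounds-cong _ N (h≗h′ ∘ suc)))

-- Extra balls never create empty rounds, and each of the x′ ∸ x extra balls fills at most one.
emptyRounds-load-≤ : ∀ N x x′ h → emptyRounds x h N ≤ emptyRounds x′ h N + (x′ ∸ x)
emptyRounds-load-≤ zero    x       x′       h = z≤n
emptyRounds-load-≤ (suc N) zero    zero     h = m≤m+n _ 0
emptyRounds-load-≤ (suc N) zero    (suc b)  h = begin
  1 + emptyRounds (h 0) (h ∘ suc) N ≤⟨ +-monoʳ-≤ 1 (emptyRounds-load-≤ N _ _ (h ∘ suc)) ⟩
  1 + (E′ + (b + h 0 ∸ h 0))        ≡⟨ cong (λ d → 1 + (E′ + d)) (m+n∸n≡m b (h 0)) ⟩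
  1 + (E′ + b)                      ≡⟨ sym (+-suc E′ b) ⟩
  E′ + suc b                        ∎
  where
  open ≤-Reasoning
  E′ = emptyRounds (b + h 0) (h ∘ suc) N
emptyRounds-load-≤ (suc N) (suc a) zero    h = begin
  emptyRounds (a + h 0) (h ∘ suc) N ≤⟨ emptyRounds-load-≤ N _ _ (h ∘ suc) ⟩
  E′ + (h 0 ∸ (a + h 0))            ≡⟨ cong (E′ +_) (m≤n⇒m∸n≡0 (m≤n+m (h 0) a)) ⟩
  E′ + 0                            ≤⟨ n≤1+n _ ⟩
  1 + E′ + 0                        ∎
  where
  open ≤-Reasoning
  E′ = emptyRounds (h 0) (h ∘ suc) N
emptyRounds-load-≤ (suc N) (suc a) (suc b) h = begin
  emptyRounds (a + h 0) (h ∘ suc) N ≤⟨ emptyRounds-load-≤ N _ _ (h ∘ suc) ⟩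
  E′ + (b + h 0 ∸ (a + h 0))        ≡⟨ cong (E′ +_) (∸-cancel-+ʳ b a (h 0)) ⟩
  E′ + (b ∸ a)                      ∎
  where
  open ≤-Reasoning
  E′ = emptyRounds (b + h 0) (h ∘ suc) N
  ∸-cancel-+ʳ : ∀ m n o → m + o ∸ (n + o) ≡ m ∸ n
  ∸-cancel-+ʳ m n o = trans (cong₂ _∸_ (+-comm m o) (+-comm n o)) ([m+n]∸[m+o]≡n∸o o m n)

emptyRounds-arrivals-≤ : ∀ N x {h h′} r → (∀ k → k ≢ r → h k ≡ h′ k) →
                         emptyRounds x h N ≤ emptyRounds x h′ N + (h′ r ∸ h r)
emptyRounds-arrivals-≤ zero    x         r       h≡h′ = z≤n
emptyRounds-arrivals-≤ (suc N) x {h} {h′} zero h≡h′ = begin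
  e + emptyRounds (x ∸ 1 + h 0) (h ∘ suc) N
    ≤⟨ +-monoʳ-≤ e (emptyRounds-load-≤ N _ (x ∸ 1 + h′ 0) (h ∘ suc)) ⟩
  e + (emptyRounds (x ∸ 1 + h′ 0) (h ∘ suc) N + d)
    ≡⟨ cong (λ E → e + (E + d)) (emptyRounds-cong _ N (λ k → h≡h′ (suc k) λ ())) ⟩
  e + (E′ + d)
    ≡⟨ cong (λ d → e + (E′ + d)) ([m+n]∸[m+o]≡n∸o (x ∸ 1) (h′ 0) (h 0)) ⟩
  e + (E′ + (h′ 0 ∸ h 0))
    ≡⟨ sym (+-assoc e E′ _) ⟩
  emptyRounds x h′ (suc N) + (h′ 0 ∸ h 0)
    ∎
  where
  open ≤-Reasoning
  e  = 𝟙 (x ℕ.≟ 0)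
  d  = x ∸ 1 + h′ 0 ∸ (x ∸ 1 + h 0)
  E′ = emptyRounds (x ∸ 1 + h′ 0) (h′ ∘ suc) N
emptyRounds-arrivals-≤ (suc N) x {h} {h′} (suc r) h≡h′ = begin
  e + emptyRounds (x ∸ 1 + h 0) (h ∘ suc) N
    ≡⟨ cong (λ a → e + emptyRounds (x ∸ 1 + a) (h ∘ suc) N) (h≡h′ 0 λ ()) ⟩
  e + emptyRounds (x ∸ 1 + h′ 0) (h ∘ suc) N
    ≤⟨ +-monoʳ-≤ e (emptyRounds-arrivals-≤ N _ r (λ k k≢r → h≡h′ (suc k) (k≢r ∘ suc-injective))) ⟩
  e + (emptyRounds (x ∸ 1 + h′ 0) (h′ ∘ suc) N + (h′ (suc r) ∸ h (suc r)))
    ≡⟨ sym (+-assoc e _ _) ⟩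
  emptyRounds x h′ (suc N) + (h′ (suc r) ∸ h (suc r))
    ∎
  where
  open ≤-Reasoning
  e = 𝟙 (x ℕ.≟ 0)

hits-∑ : ∀ {n} (A : Fin n → Fin n) i → hits A i ≡ ∑[ j < n ] 𝟙 (A j ≟ i)
hits-∑ A i = sum-map-allFin (λ j → 𝟙 (A j ≟ i))

hits-cong : ∀ {n} {A B : Fin n → Fin n} → A ≗ B → hits A ≗ hits B
hits-cong {n} {A} {B} A≗B i = begin
  hits A i                 ≡⟨ hits-∑ A i ⟩
  ∑[ j < n ] 𝟙 (A j ≟ i)   ≡⟨ sum-cong-≗ {n} (λ j → cong (λ b → 𝟙 (b ≟ i)) (A≗B j)) ⟩
  ∑[ j < n ] 𝟙 (B j ≟ i)   ≡⟨ hits-∑ B i ⟨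
  hits B i                 ∎
  where open ≡-Reasoning

hits-≤-except : ∀ {n} {A B : Fin n → Fin n} j → (∀ j′ → j′ ≢ j → A j′ ≡ B j′) →
                ∀ i → hits B i ≤ hits A i + 𝟙 (B j ≟ i)
hits-≤-except {n} {A} {B} j A≡B i = begin
  hits B i                               ≡⟨ hits-∑ B i ⟩
  ∑[ j′ < n ] 𝟙 (B j′ ≟ i)               ≤⟨ ∑-mono-≤-except j (λ j′ j′≢j → ≤-reflexive (cong (λ b → 𝟙 (b ≟ i)) (sym (A≡B j′ j′≢j)))) ⟩
  ∑[ j′ < n ] 𝟙 (A j′ ≟ i) + 𝟙 (B j ≟ i) ≡⟨ cong (_+ 𝟙 (B j ≟ i)) (hits-∑ A i) ⟨
  hits A i + 𝟙 (B j ≟ i)                 ∎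
  where open ≤-Reasoning

arrivals : ∀ {n} → Choices n → ℕ → Fin n → ℕ → ℕ
arrivals Z t0 i k = hits (Z (t0 + k)) i

run-queue : ∀ {n} (y0 : Load n) Z t0 k i → run y0 Z t0 k i ≡ queue (y0 i) (arrivals Z t0 i) k
run-queue y0 Z t0 zero    i = refl
run-queue y0 Z t0 (suc k) i = cong (λ y → (y ∸ 1) + hits (Z (t0 + k)) i) (run-queue y0 Z t0 k i)

G-∑-emptyRounds : ∀ {n} (y0 : Load n) Z t0 t3 →
                  G y0 Z t0 t3 ≡ ∑[ i < n ] emptyRounds (y0 i) (arrivals Z t0 i) (suc (t3 ∸ t0))
G-∑-emptyRounds {n} y0 Z t0 t3 = begin
  G y0 Z t0 t3
    ≡⟨ sum-applyUpTo (λ k → empties (loadAt y0 Z t0 (t0 + k))) N ⟩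
  ∑[ k < N ] empties (loadAt y0 Z t0 (t0 + toℕ k))
    ≡⟨ sum-cong-≗ {N} (empties-queue ∘ toℕ) ⟩
  ∑[ k < N ] ∑[ i < n ] isEmpty (toℕ k) i
    ≡⟨ ∑-comm {N} {n} (λ k i → isEmpty (toℕ k) i) ⟩
  ∑[ i < n ] ∑[ k < N ] isEmpty (toℕ k) i
    ≡⟨ sum-cong-≗ {n} (λ i → emptyRounds-∑ (y0 i) (arrivals Z t0 i) N) ⟨
  ∑[ i < n ] emptyRounds (y0 i) (arrivals Z t0 i) N
    ∎
  where
  open ≡-Reasoning
  N = suc (t3 ∸ t0)
  isEmpty : ℕ → Fin n → ℕ
  isEmpty k i = 𝟙 (queue (y0 i) (arrivals Z t0 i) k ℕ.≟ 0)
  empties-queue : ∀ k → empties (loadAt y0 Z t0 (t0 + k)) ≡ ∑[ i < n ] isEmpty k i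
  empties-queue k = begin
    empties (run y0 Z t0 (t0 + k ∸ t0))     ≡⟨ cong (empties ∘ run y0 Z t0) (m+n∸m≡n t0 k) ⟩
    empties (run y0 Z t0 k)                 ≡⟨ sum-map-allFin (λ i → 𝟙 (run y0 Z t0 k i ℕ.≟ 0)) ⟩
    ∑[ i < n ] 𝟙 (run y0 Z t0 k i ℕ.≟ 0)   ≡⟨ sum-cong-≗ {n} (λ i → cong (λ y → 𝟙 (y ℕ.≟ 0)) (run-queue y0 Z t0 k i)) ⟩
    ∑[ i < n ] isEmpty k i                  ∎

AgreeExceptAt : ∀ {n} → ℕ → Fin n → Choices n → Choices n → Set
AgreeExceptAt t j Z Z′ = ∀ s i → ¬ (s ≡ t × i ≡ j) → Z s i ≡ Z′ s i

AgreeExceptAt-sym : ∀ {n t} {j : Fin n} {Z Z′} → AgreeExceptAt t j Z Z′ → AgreeExceptAt t j Z′ Z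
AgreeExceptAt-sym agree s i s,i≢t,j = sym (agree s i s,i≢t,j)

G-≤-resample : ∀ {n} (y0 : Load n) {t0 t3 t} {j : Fin n} {Z Z′ : Choices n} →
               t0 ≤ t → AgreeExceptAt t j Z Z′ → G y0 Z t0 t3 ≤ G y0 Z′ t0 t3 + 1
G-≤-resample {n} y0 {t0} {t3} {t} {j} {Z} {Z′} t0≤t agree = begin
  G y0 Z t0 t3                                    ≡⟨ G-∑-emptyRounds y0 Z t0 t3 ⟩
  ∑[ i < n ] E Z i                                ≤⟨ ∑-mono-≤ per-bin ⟩
  ∑[ i < n ] (E Z′ i + 𝟙 (Z′ t j ≟ i))            ≡⟨ ∑-distrib-+ (E Z′) (λ i → 𝟙 (Z′ t j ≟ i)) ⟩
  ∑[ i < n ] E Z′ i + ∑[ i < n ] 𝟙 (Z′ t j ≟ i)   ≡⟨ cong₂ _+_ (sym (G-∑-emptyRounds y0 Z′ t0 t3)) (∑-𝟙-≟ (Z′ t j)) ⟩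
  G y0 Z′ t0 t3 + 1                               ∎
  where
  open ≤-Reasoning
  N = suc (t3 ∸ t0)
  r = t ∸ t0
  E : Choices n → Fin n → ℕ
  E Y i = emptyRounds (y0 i) (arrivals Y t0 i) N
  same-off-r : ∀ i k → k ≢ r → arrivals Z t0 i k ≡ arrivals Z′ t0 i k
  same-off-r i k k≢r = hits-cong (λ j′ → agree (t0 + k) j′ λ (t0+k≡t , _) →
    k≢r (trans (sym (m+n∸m≡n t0 k)) (cong (_∸ t0) t0+k≡t))) i
  extra-at-r : ∀ i → arrivals Z′ t0 i r ≤ arrivals Z t0 i r + 𝟙 (Z′ t j ≟ i)
  extra-at-r i = subst (λ s → hits (Z′ s) i ≤ hits (Z s) i + 𝟙 (Z′ t j ≟ i)) (sym (m+[n∸m]≡n t0≤t))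
    (hits-≤-except j (λ j′ j′≢j → agree t j′ λ (_ , j′≡j) → j′≢j j′≡j) i)
  per-bin : ∀ i → E Z i ≤ E Z′ i + 𝟙 (Z′ t j ≟ i)
  per-bin i = ≤-trans (emptyRounds-arrivals-≤ N (y0 i) r (same-off-r i))
                      (+-monoʳ-≤ (E Z′ i) (m≤n+o⇒m∸n≤o _ _ (extra-at-r i)))

lemma4p8 : (n m : ℕ) → 6 * n ≤ m → (y0 : Load n) → total y0 ≡ m
    → (t0 t3 : ℕ) → t0 ≤ t3
    → (Z Z′ : Choices n) (t : ℕ) (j : Fin n) → t0 ≤ t → t < t3
    → (∀ s i → ¬ (s ≡ t × i ≡ j) → Z s i ≡ Z′ s i)
    → (G y0 Z t0 t3 ≤ G y0 Z′ t0 t3 + 1) × (G y0 Z′ t0 t3 ≤ G y0 Z t0 t3 + 1)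
lemma4p8 n m _ y0 _ t0 t3 _ Z Z′ t j t0≤t _ agree =
  G-≤-resample y0 t0≤t agree , G-≤-resample y0 t0≤t (AgreeExceptAt-sym agree)
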